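{- Let $G$ be a snake graph with edge set $E(G)$ and set of tiles $S(G)$. Let $\overline{P}(G)\subset\mathbb{R}^{E(G)}$ be the convex hull of the indicator vectors $\chi_M$ of all perfect matchings $M$ of $G$, and let $\overline{P}^{\mathrm{pc}}(G)\subset\mathbb{R}^{E(G)}\times\mathbb{R}^{S(G)}$ be the convex hull of the vectors $(\chi_M,\chi_{C(M)})$ over all perfect matchings $M$ of $G$. Then every lattice point of $\overline{P}(G)$ is a vertex of $\overline{P}(G)$ and equals $\chi_M$ for some perfect matching $M$, and every lattice point of $\overline{P}^{\mathrm{pc}}(G)$ is a vertex of $\overline{P}^{\mathrm{pc}}(G)$ and equals $(\chi_M,\chi_{C(M)})$ for some perfect matching $M$.
   Context: A snake graph is a planar graph formed by a finite sequence of unit squares (tiles) $S_1,\dots,S_d$ in $\mathbb{R}^2$, where for each $i$ the tile $S_{i+1}$ is glued to $S_i$ along either the north edge or the east edge of $S_i$; edges are the sides of the tiles (shared sides counted once). The bottom matching $M_0$ is the perfect matching consisting only of boundary edges of $G$ and containing the south edge of $S_1$. For any perfect matching $M$, the symmetric difference $M\ominus M_0$ is the boundary of a union of tiles; $C(M)$ denotes this set of tiles.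
   Formalization: The polytopes $\overline{P}(G)$ and $\overline{P}^{\mathrm{pc}}(G)$ are taken over ℚ instead of ℝ, with rational convex weights, and being a vertex is tested only against rational points of the hull with rational coefficients. -}

module Defs where

open import Data.Bool using (Bool; true; false; _∧_; _∨_; _xor_; if_then_else_; T)
open import Data.Nat as ℕ using (ℕ; zero; suc; _≡ᵇ_)
open import Data.Fin using (Fin; zero; suc)
open import Data.Vec using (Vec; []; _∷_)
open import Data.List using (List; []; _∷_; allFin; foldr)
open import Data.List.Relation.Unary.All using (All)
open import Data.Product using (Σ; ∃; _×_; _,_; proj₁; proj₂)
open import Data.Sum using (_⊎_; inj₁; inj₂)
open import Data.Integer using (ℤ)
open import Data.Rational using (ℚ; 0ℚ; 1ℚ; _+_; _*_; _-_; _≤_; _<_; _/_)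
open import Relation.Binary.PropositionalEquality using (_≡_)

Point : Set
Point = ℕ × ℕ

-- Unit lattice segments: hor x y is the segment (x,y)-(x+1,y),
-- ver x y is the segment (x,y)-(x,y+1).
data Edge : Set where
  hor : ℕ → ℕ → Edge
  ver : ℕ → ℕ → Edge

_==E_ : Edge → Edge → Bool
hor a b ==E hor c d = (a ≡ᵇ c) ∧ (b ≡ᵇ d)
ver a b ==E ver c d = (a ≡ᵇ c) ∧ (b ≡ᵇ d)
_ ==E _ = false

_==P_ : Point → Point → Bool
(a , b) ==P (c , d) = (a ≡ᵇ c) ∧ (b ≡ᵇ d)

anyB : {A : Set} → (A → Bool) → List A → Bool
anyB p = foldr (λ a b → p a ∨ b) false

countB : {A : Set} → (A → Bool) → List A → ℕ
countB p = foldr (λ a n → if p a then suc n else n) zero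

-- The unit square (tile) with lower-left corner (x , y): its four sides
-- (south, north, west, east) and its four corners.
sides : Point → List Edge
sides (x , y) = hor x y ∷ hor x (suc y) ∷ ver x y ∷ ver (suc x) y ∷ []

corners : Point → List Point
corners (x , y) = (x , y) ∷ (suc x , y) ∷ (x , suc y) ∷ (suc x , suc y) ∷ []

incident : Point → List Edge
incident (x , y) = hor x y ∷ ver x y ∷ left x ++' down y
  where
  left : ℕ → List Edge
  left zero = []
  left (suc x') = hor x' y ∷ []
  down : ℕ → List Edge
  down zero = []
  down (suc y') = ver x y' ∷ []
  _++'_ : List Edge → List Edge → List Edge
  [] ++' ys = ys
  (z ∷ zs) ++' ys = z ∷ (zs ++' ys)

-- Gluing direction: S_{i+1} is glued to the north or east edge of S_i.
data Step : Set where
  N E : Step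

step : Step → Point → Point
step N (x , y) = (x , suc y)
step E (x , y) = (suc x , y)

-- A snake graph with d = suc k tiles is given by its k gluing steps.
-- tile ds i is the lower-left corner of tile S_{i+1}; S_1 sits at (0,0).
tile : {k : ℕ} → Vec Step k → Fin (suc k) → Point
tile ds zero = (0 , 0)
tile (s ∷ ds) (suc i) = step s (tile ds i)

-- Set of tiles S(G) is Fin (suc k).
-- Number of tiles in a set C of tiles having e as a side.
mult : {k : ℕ} → Vec Step k → (Fin (suc k) → Bool) → Edge → ℕ
mult {k} ds C e = countB (λ i → C i ∧ anyB (_==E_ e) (sides (tile ds i))) (allFin (suc k))

allTiles : {k : ℕ} → Fin (suc k) → Bool
allTiles _ = true

inG : {k : ℕ} → Vec Step k → Edge → Bool
inG ds e = 1 ℕ.≤ᵇ mult ds allTiles e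

isBoundaryEdge : {k : ℕ} → Vec Step k → Edge → Bool
isBoundaryEdge ds e = mult ds allTiles e ≡ᵇ 1

isVertex : {k : ℕ} → Vec Step k → Point → Bool
isVertex {k} ds v = anyB (λ i → anyB (_==P_ v) (corners (tile ds i))) (allFin (suc k))

EdgeG : {k : ℕ} → Vec Step k → Set
EdgeG ds = Σ Edge (λ e → T (inG ds e))

IsPerfectMatching : {k : ℕ} → Vec Step k → (Edge → Bool) → Set
IsPerfectMatching ds M =
  (∀ e → T (M e) → T (inG ds e)) ×
  (∀ v → T (isVertex ds v) → countB M (incident v) ≡ 1)

IsBottomMatching : {k : ℕ} → Vec Step k → (Edge → Bool) → Set
IsBottomMatching ds M0 =
  IsPerfectMatching ds M0 ×
  (∀ e → T (M0 e) → T (isBoundaryEdge ds e)) ×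
  T (M0 (hor 0 0))

-- C is C(M): the symmetric difference M ⊖ M_0 is the boundary of the
-- union of the tiles in C, i.e. exactly the edges lying in exactly one
-- tile of C.
IsCSet : {k : ℕ} → Vec Step k → (M0 M : Edge → Bool) → (Fin (suc k) → Bool) → Set
IsCSet ds M0 M C = ∀ e → (mult ds C e ≡ᵇ 1) ≡ (M e xor M0 e)

χ : Bool → ℚ
χ b = if b then 1ℚ else 0ℚ

InHull : {I : Set} → ((I → ℚ) → Set) → (I → ℚ) → Set
InHull {I} Gen x =
  Σ (List (ℚ × (I → ℚ))) λ ws →
    All (λ wp → (0ℚ ≤ proj₁ wp) × Gen (proj₂ wp)) ws ×
    (foldr (λ wp s → proj₁ wp + s) 0ℚ ws ≡ 1ℚ) ×
    (∀ i → x i ≡ foldr (λ wp s → proj₁ wp * proj₂ wp i + s) 0ℚ ws)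

IsLattice : {I : Set} → (I → ℚ) → Set
IsLattice {I} x = ∀ i → ∃ λ (n : ℤ) → x i ≡ n / 1

IsVertexOfHull : {I : Set} → ((I → ℚ) → Set) → (I → ℚ) → Set
IsVertexOfHull {I} Gen x =
  InHull Gen x ×
  (∀ y z t → InHull Gen y → InHull Gen z → 0ℚ < t → t < 1ℚ →
     (∀ i → x i ≡ t * y i + (1ℚ - t) * z i) → ∀ i → y i ≡ x i)

χM : {k : ℕ} (ds : Vec Step k) → (Edge → Bool) → EdgeG ds → ℚ
χM ds M (e , _) = χ (M e)

PMPoint : {k : ℕ} (ds : Vec Step k) → (EdgeG ds → ℚ) → Set
PMPoint ds p = ∃ λ M → IsPerfectMatching ds M × (∀ i → p i ≡ χM ds M i)

χMC : {k : ℕ} (ds : Vec Step k) → (Edge → Bool) → (Fin (suc k) → Bool) →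
      (EdgeG ds ⊎ Fin (suc k)) → ℚ
χMC ds M C (inj₁ e) = χM ds M e
χMC ds M C (inj₂ i) = χ (C i)

PCPoint : {k : ℕ} (ds : Vec Step k) → (Edge → Bool) →
          (EdgeG ds ⊎ Fin (suc k) → ℚ) → Set
PCPoint ds M0 p = ∃ λ M → ∃ λ C →
  IsPerfectMatching ds M × IsCSet ds M0 M C × (∀ i → p i ≡ χMC ds M C i)

-- Every generator of either polytope is a 0/1-vector, so both polytopes lie in the unit cube,
-- and a lattice point x of the hull is itself a 0/1-vector. Writing x = Σ wⱼ pⱼ with Σ wⱼ = 1,
-- a coordinate with xᵢ = 0 forces wⱼ pⱼᵢ = 0 and one with xᵢ = 1 forces wⱼ pⱼᵢ = wⱼ, so every
-- generator of nonzero weight equals x. For the same reason x cannot lie strictly inside a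
-- segment of the cube unless that segment is constant in every coordinate, so x is a vertex.
module Submission where

open import Defs
open import Data.Nat using (ℕ; suc; s≤s)
open import Data.Vec using (Vec)
open import Data.Integer as ℤ using (ℤ; -[1+_]; +≤+)
import Data.Nat.Coprimality as Coprimality
open import Data.Rational using (ℚ; 0ℚ; 1ℚ; _+_; _*_; _-_; -_; _≤_; _<_; _/_; *≤*; positive; nonNegative)
open import Data.Rational.Properties
open import Data.Bool using (true; false)
open import Data.Product using (_×_; ∃-syntax; _,_; proj₁; proj₂)
open import Data.Sum as Sum using (_⊎_; inj₁; inj₂)
open import Data.List using (List; []; _∷_; foldr)
open import Data.List.Membership.Propositional using (_∈_)
open import Data.List.Relation.Unary.Any using (here; there)
open import Data.List.Relation.Unary.All as All using (All)
open import Data.Empty using (⊥-elim)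
open import Function using (_∘_)
open import Relation.Nullary using (yes; no)
open import Relation.Binary.PropositionalEquality

IsBit : ℚ → Set
IsBit q = q ≡ 0ℚ ⊎ q ≡ 1ℚ

χ-isBit : ∀ b → IsBit (χ b)
χ-isBit true  = inj₂ refl
χ-isBit false = inj₁ refl

integer-isBit : ∀ (n : ℤ) → 0ℚ ≤ n / 1 → n / 1 ≤ 1ℚ → IsBit (n / 1)
integer-isBit (ℤ.+ 0) _ _ = inj₁ refl
integer-isBit (ℤ.+ 1) _ _ = inj₂ refl
-- n / 1 normalises to the fraction n/1 itself, so the bounds become inequalities of integers.
integer-isBit (ℤ.+ suc (suc m)) _ n≤1
  rewrite normalize-coprime {suc (suc m)} {0} (Coprimality.sym (Coprimality.1-coprimeTo _))
  with n≤1
... | *≤* (+≤+ (s≤s ()))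
integer-isBit -[1+ m ] 0≤n _
  rewrite normalize-coprime {suc m} {0} (Coprimality.sym (Coprimality.1-coprimeTo _))
  with 0≤n
... | *≤* ()

*-isBit-bounds : ∀ {w v} → 0ℚ ≤ w → IsBit v → 0ℚ ≤ w * v × w * v ≤ w
*-isBit-bounds {w} 0≤w (inj₁ refl) rewrite *-zeroʳ w     = ≤-refl , 0≤w
*-isBit-bounds {w} 0≤w (inj₂ refl) rewrite *-identityʳ w = 0≤w , ≤-refl

*-cancelˡ-isBit : ∀ {w u v} → w ≢ 0ℚ → IsBit u → IsBit v → w * u ≡ w * v → u ≡ v
*-cancelˡ-isBit _ (inj₁ refl) (inj₁ refl) _ = refl
*-cancelˡ-isBit _ (inj₂ refl) (inj₂ refl) _ = refl
*-cancelˡ-isBit {w} w≢0 (inj₁ refl) (inj₂ refl) eq =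
  ⊥-elim (w≢0 (trans (sym (*-identityʳ w)) (trans (sym eq) (*-zeroʳ w))))
*-cancelˡ-isBit {w} w≢0 (inj₂ refl) (inj₁ refl) eq =
  ⊥-elim (w≢0 (trans (sym (*-identityʳ w)) (trans eq (*-zeroʳ w))))

*-cancelˡ-≡-pos : ∀ {r p q} → 0ℚ < r → r * p ≡ r * q → p ≡ q
*-cancelˡ-≡-pos {r} 0<r eq =
  ≤-antisym (*-cancelˡ-≤-pos r (≤-reflexive eq)) (*-cancelˡ-≤-pos r (≤-reflexive (sym eq)))
  where instance _ = positive 0<r

≤-+-≡⇒≡ : ∀ {a b c d} → a ≤ b → c ≤ d → a + c ≡ b + d → a ≡ b × c ≡ d
≤-+-≡⇒≡ a≤b c≤d eq =
  ≤-antisym a≤b (≮⇒≥ λ a<b → <-irrefl eq (+-mono-<-≤ a<b c≤d)) ,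
  ≤-antisym c≤d (≮⇒≥ λ c<d → <-irrefl eq (+-mono-≤-< a≤b c<d))

≤1⇒0≤1- : ∀ {t} → t ≤ 1ℚ → 0ℚ ≤ 1ℚ - t
≤1⇒0≤1- {t} t≤1 = subst (_≤ 1ℚ - t) (+-inverseʳ t) (+-mono-≤ t≤1 (≤-refl { - t}))

convex-combination-const : ∀ t c → t * c + (1ℚ - t) * c ≡ c
convex-combination-const t c = begin
  t * c + (1ℚ - t) * c   ≡⟨ *-distribʳ-+ c t (1ℚ - t) ⟨
  (t + (1ℚ - t)) * c     ≡⟨ cong (_* c) t+[1-t]≡1 ⟩
  1ℚ * c                 ≡⟨ *-identityˡ c ⟩
  c                      ∎
  where
  open ≡-Reasoning
  t+[1-t]≡1 : t + (1ℚ - t) ≡ 1ℚ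
  t+[1-t]≡1 = begin
    t + (1ℚ - t)   ≡⟨ cong (t +_) (+-comm 1ℚ (- t)) ⟩
    t + (- t + 1ℚ) ≡⟨ +-assoc t (- t) 1ℚ ⟨
    (t - t) + 1ℚ   ≡⟨ cong (_+ 1ℚ) (+-inverseʳ t) ⟩
    0ℚ + 1ℚ        ≡⟨ +-identityˡ 1ℚ ⟩
    1ℚ             ∎

convex≡lowerBound⇒≡ : ∀ {t y z c} → 0ℚ < t → t ≤ 1ℚ → c ≤ y → c ≤ z →
                      t * y + (1ℚ - t) * z ≡ c → y ≡ c
convex≡lowerBound⇒≡ {t} {y} {z} {c} 0<t t≤1 c≤y c≤z eq =
  sym (*-cancelˡ-≡-pos 0<t (proj₁ (≤-+-≡⇒≡
    (*-monoˡ-≤-nonNeg t c≤y) (*-monoˡ-≤-nonNeg (1ℚ - t) c≤z)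
    (trans (convex-combination-const t c) (sym eq)))))
  where
  instance _ = nonNegative (<⇒≤ 0<t)
  instance _ = nonNegative (≤1⇒0≤1- t≤1)

convex≡upperBound⇒≡ : ∀ {t y z c} → 0ℚ < t → t ≤ 1ℚ → y ≤ c → z ≤ c →
                      t * y + (1ℚ - t) * z ≡ c → y ≡ c
convex≡upperBound⇒≡ {t} {y} {z} {c} 0<t t≤1 y≤c z≤c eq =
  *-cancelˡ-≡-pos 0<t (proj₁ (≤-+-≡⇒≡
    (*-monoˡ-≤-nonNeg t y≤c) (*-monoˡ-≤-nonNeg (1ℚ - t) z≤c)
    (trans eq (sym (convex-combination-const t c)))))
  where
  instance _ = nonNegative (<⇒≤ 0<t)
  instance _ = nonNegative (≤1⇒0≤1- t≤1)

-- Definitionally the shape of the weight and coordinate sums in InHull.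
sumBy : {A : Set} → (A → ℚ) → List A → ℚ
sumBy f = foldr (λ a s → f a + s) 0ℚ

module _ {A : Set} where

  sumBy-zero : ∀ (xs : List A) → sumBy (λ _ → 0ℚ) xs ≡ 0ℚ
  sumBy-zero []       = refl
  sumBy-zero (_ ∷ xs) = trans (+-identityˡ _) (sumBy-zero xs)

  sumBy-mono-≤ : ∀ {f g : A → ℚ} xs → (∀ {a} → a ∈ xs → f a ≤ g a) →
                 sumBy f xs ≤ sumBy g xs
  sumBy-mono-≤ []       _   = ≤-refl
  sumBy-mono-≤ (_ ∷ xs) f≤g = +-mono-≤ (f≤g (here refl)) (sumBy-mono-≤ xs (f≤g ∘ there))

  sumBy-≤-≡⇒≡ : ∀ {f g : A → ℚ} xs → (∀ {a} → a ∈ xs → f a ≤ g a) →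
                sumBy f xs ≡ sumBy g xs → ∀ {a} → a ∈ xs → f a ≡ g a
  sumBy-≤-≡⇒≡ (_ ∷ xs) f≤g eq (here refl) =
    proj₁ (≤-+-≡⇒≡ (f≤g (here refl)) (sumBy-mono-≤ xs (f≤g ∘ there)) eq)
  sumBy-≤-≡⇒≡ (_ ∷ xs) f≤g eq (there a∈) =
    sumBy-≤-≡⇒≡ xs (f≤g ∘ there)
      (proj₂ (≤-+-≡⇒≡ (f≤g (here refl)) (sumBy-mono-≤ xs (f≤g ∘ there)) eq)) a∈

  sumBy-≢0⇒∃ : ∀ {f : A → ℚ} xs → sumBy f xs ≢ 0ℚ → ∃[ a ] a ∈ xs × f a ≢ 0ℚ
  sumBy-≢0⇒∃ []           s≢0 = ⊥-elim (s≢0 refl)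
  sumBy-≢0⇒∃ {f} (x ∷ xs) s≢0 with f x ≟ 0ℚ
  ... | no fx≢0 = x , here refl , fx≢0
  ... | yes fx≡0 with sumBy-≢0⇒∃ xs (λ s≡0 → s≢0 (trans (cong₂ _+_ fx≡0 s≡0) (+-identityˡ 0ℚ)))
  ...   | a , a∈ , fa≢0 = a , there a∈ , fa≢0

module ZeroOneHull {I : Set} (G : (I → ℚ) → Set)
  (G-isBit : ∀ {p} → G p → ∀ i → IsBit (p i))
  (G-resp-≗ : ∀ {p q} → G p → p ≗ q → G q) where

  coordinate : I → ℚ × (I → ℚ) → ℚ
  coordinate i wp = proj₁ wp * proj₂ wp i

  coordinate-bounds : ∀ {ws} → All (λ wp → 0ℚ ≤ proj₁ wp × G (proj₂ wp)) ws →
                      ∀ i {wp} → wp ∈ ws → 0ℚ ≤ coordinate i wp × coordinate i wp ≤ proj₁ wp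
  coordinate-bounds ok i wp∈ =
    let (0≤w , Gp) = All.lookup ok wp∈ in *-isBit-bounds 0≤w (G-isBit Gp i)

  hull-bounds : ∀ {x} → InHull G x → ∀ i → 0ℚ ≤ x i × x i ≤ 1ℚ
  hull-bounds (ws , ok , Σw≡1 , x≡Σ) i rewrite x≡Σ i =
    subst (_≤ sumBy (coordinate i) ws) (sumBy-zero ws) (sumBy-mono-≤ ws (proj₁ ∘ coordinate-bounds ok i)) ,
    subst (sumBy (coordinate i) ws ≤_) Σw≡1 (sumBy-mono-≤ ws (proj₂ ∘ coordinate-bounds ok i))

  lattice-isBit : ∀ {x} → InHull G x → IsLattice x → ∀ i → IsBit (x i)
  lattice-isBit hull lattice i with lattice i
  ... | n , xᵢ≡n =
    let (0≤xᵢ , xᵢ≤1) = hull-bounds hull i in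
    Sum.map (trans xᵢ≡n) (trans xᵢ≡n)
      (integer-isBit n (subst (0ℚ ≤_) xᵢ≡n 0≤xᵢ) (subst (_≤ 1ℚ) xᵢ≡n xᵢ≤1))

  lattice-generator : ∀ {x} → InHull G x → IsLattice x → G x
  lattice-generator {x} hull@(ws , ok , Σw≡1 , x≡Σ) lattice
    with sumBy-≢0⇒∃ {f = proj₁} ws (λ Σw≡0 → 1≢0 (trans (sym Σw≡1) Σw≡0))
  ... | (w , p) , wp∈ , w≢0 = G-resp-≗ Gp p≗x
    where
    Gp : G p
    Gp = proj₂ (All.lookup ok wp∈)
    p≗x : p ≗ x
    p≗x i with lattice-isBit hull lattice i
    ... | inj₁ xᵢ≡0 = *-cancelˡ-isBit w≢0 (G-isBit Gp i) (inj₁ xᵢ≡0) (begin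
      w * p i   ≡⟨ sumBy-≤-≡⇒≡ ws (λ wq∈ → proj₁ (coordinate-bounds ok i wq∈))
                     (trans (sumBy-zero ws) (trans (sym xᵢ≡0) (x≡Σ i))) wp∈ ⟨
      0ℚ        ≡⟨ *-zeroʳ w ⟨
      w * 0ℚ    ≡⟨ cong (w *_) xᵢ≡0 ⟨
      w * x i   ∎)
      where open ≡-Reasoning
    ... | inj₂ xᵢ≡1 = *-cancelˡ-isBit w≢0 (G-isBit Gp i) (inj₂ xᵢ≡1) (begin
      w * p i   ≡⟨ sumBy-≤-≡⇒≡ ws (λ wq∈ → proj₂ (coordinate-bounds ok i wq∈))
                     (trans (sym (x≡Σ i)) (trans xᵢ≡1 (sym Σw≡1))) wp∈ ⟩
      w         ≡⟨ *-identityʳ w ⟨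
      w * 1ℚ    ≡⟨ cong (w *_) xᵢ≡1 ⟨
      w * x i   ∎)
      where open ≡-Reasoning

  lattice-vertex : ∀ {x} → InHull G x → IsLattice x → IsVertexOfHull G x
  lattice-vertex {x} hull lattice = hull , segment-constant
    where
    segment-constant : ∀ y z t → InHull G y → InHull G z → 0ℚ < t → t < 1ℚ →
          (∀ i → x i ≡ t * y i + (1ℚ - t) * z i) → ∀ i → y i ≡ x i
    segment-constant y z t hy hz 0<t t<1 x≡ i with lattice-isBit hull lattice i
    ... | inj₁ xᵢ≡0 = trans
      (convex≡lowerBound⇒≡ 0<t (<⇒≤ t<1) (proj₁ (hull-bounds hy i)) (proj₁ (hull-bounds hz i))
        (trans (sym (x≡ i)) xᵢ≡0))
      (sym xᵢ≡0)
    ... | inj₂ xᵢ≡1 = trans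
      (convex≡upperBound⇒≡ 0<t (<⇒≤ t<1) (proj₂ (hull-bounds hy i)) (proj₂ (hull-bounds hz i))
        (trans (sym (x≡ i)) xᵢ≡1))
      (sym xᵢ≡1)

  lattice-point-characterisation : ∀ {x} → InHull G x → IsLattice x → IsVertexOfHull G x × G x
  lattice-point-characterisation hull lattice = lattice-vertex hull lattice , lattice-generator hull lattice

module _ {k : ℕ} (ds : Vec Step k) where

  PMPoint-isBit : ∀ {p} → PMPoint ds p → ∀ i → IsBit (p i)
  PMPoint-isBit (M , _ , p≗χ) i@(e , _) rewrite p≗χ i = χ-isBit (M e)

  PMPoint-resp-≗ : ∀ {p q} → PMPoint ds p → p ≗ q → PMPoint ds q
  PMPoint-resp-≗ (M , pm , p≗χ) p≗q = M , pm , λ i → trans (sym (p≗q i)) (p≗χ i)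

  PCPoint-isBit : ∀ M0 {p} → PCPoint ds M0 p → ∀ i → IsBit (p i)
  PCPoint-isBit M0 (M , C , _ , _ , p≗χ) i@(inj₁ (e , _)) rewrite p≗χ i = χ-isBit (M e)
  PCPoint-isBit M0 (M , C , _ , _ , p≗χ) i@(inj₂ j)       rewrite p≗χ i = χ-isBit (C j)

  PCPoint-resp-≗ : ∀ M0 {p q} → PCPoint ds M0 p → p ≗ q → PCPoint ds M0 q
  PCPoint-resp-≗ M0 (M , C , pm , isC , p≗χ) p≗q = M , C , pm , isC , λ i → trans (sym (p≗q i)) (p≗χ i)

lemma3p7 : {k : ℕ} (ds : Vec Step k) →
    (∀ x → InHull (PMPoint ds) x → IsLattice x →
       IsVertexOfHull (PMPoint ds) x × PMPoint ds x) ×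
    (∀ M0 → IsBottomMatching ds M0 → ∀ x → InHull (PCPoint ds M0) x → IsLattice x →
       IsVertexOfHull (PCPoint ds M0) x × PCPoint ds M0 x)
lemma3p7 ds =
  (λ _ → PM.lattice-point-characterisation) ,
  (λ M0 _ _ → PC.lattice-point-characterisation M0)
  where
  module PM    = ZeroOneHull (PMPoint ds) (PMPoint-isBit ds) (PMPoint-resp-≗ ds)
  module PC M0 = ZeroOneHull (PCPoint ds M0) (PCPoint-isBit ds M0) (PCPoint-resp-≗ ds M0)
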